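{- Let $a,n\geq 2$ be integers, let $G\in T^P_{2,1}(a,n)$ and let $V_0\sqcup V_1$ be the canonical partition of $V(G)$. Then \[|V_0| \in \bigl[(n-1)x_{2\star},\ (n-1)x_{2\star}+1\bigr],\qquad\text{where } x_{2\star}= \frac{\log \left(\frac{a+1}{a}\right)}{\log \left(\frac{(a+1)^2}{a(a-1)}\right)}.\]
   Context: A multigraph is a pair $G=(V,w)$ where $V$ is a finite set and $w:\binom{V}{2}\to\mathbb{Z}_{\geq 0}$; $P(G)=\prod_{xy\in\binom{V}{2}}w(xy)$. For integers $a\ge 2$ and $n\ge1$, $\mathcal{T}_{2,1}(a,n)$ is the set of multigraphs $G$ on $[n]=\{1,\dots,n\}$ whose vertex set can be partitioned into two parts $V_0,V_1$ (a canonical partition) such that all pairs inside $V_0$ have multiplicity $a-1$, all pairs inside $V_1$ have multiplicity $a$, and all pairs between $V_0$ and $V_1$ have multiplicity $a+1$; $\Pi_{2,1}(a,n)=\max\{P(G):G\in\mathcal{T}_{2,1}(a,n)\}$ and $T^P_{2,1}(a,n)$ is the set of $G\in\mathcal{T}_{2,1}(a,n)$ with $P(G)=\Pi_{2,1}(a,n)$. -}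

module Defs where

open import Data.Nat using (ℕ; zero; suc; _+_; _*_; _∸_; _^_; _≤_; _<_)
open import Data.Bool using (Bool; true; false)
open import Data.Fin using (Fin) renaming (zero to fzero; suc to fsuc)
import Data.Fin as F
open import Data.Fin.Subset using (Subset; ∣_∣)
open import Data.Vec using (lookup)
open import Data.List using (map; allFin)
open import Data.Nat.ListAction using (product)
open import Data.Product using (Σ; ∃; _×_; _,_)
open import Relation.Binary.PropositionalEquality using (_≡_)

-- A multigraph on [n] = Fin n: the multiplicity of the pair {i,j} with i < j
-- is  w i j ; entries with i ≥ j are irrelevant.
Multigraph : ℕ → Set
Multigraph n = Fin n → Fin n → ℕ

P : (n : ℕ) → Multigraph n → ℕ
P zero w = 1
P (suc n) w = product (map (λ j → w fzero (fsuc j)) (allFin n))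
              * P n (λ i j → w (fsuc i) (fsuc j))

-- Multiplicity prescribed by a partition V0 ⊔ V1 (V0 = the subset p,
-- V1 its complement): a-1 inside V0, a inside V1, a+1 across.
multB : ℕ → Bool → Bool → ℕ
multB a true  true  = a ∸ 1
multB a false false = a
multB a true  false = suc a
multB a false true  = suc a

IsCanonical : (a n : ℕ) → Multigraph n → Subset n → Set
IsCanonical a n w p = ∀ (i j : Fin n) → i F.< j → w i j ≡ multB a (lookup p i) (lookup p j)

InT21 : (a n : ℕ) → Multigraph n → Set
InT21 a n w = Σ (Subset n) (λ p → IsCanonical a n w p)

InTP21 : (a n : ℕ) → Multigraph n → Set
InTP21 a n w = InT21 a n w × (∀ (h : Multigraph n) → InT21 a n h → P n h ≤ P n w)

-- k ≥ (n-1) x₂⋆ , with x₂⋆ = log((a+1)/a) / log((a+1)²/(a(a-1))),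
-- equivalently ((a+1)²/(a(a-1)))^k ≥ ((a+1)/a)^(n-1), cleared of denominators.
LowerOK : (a n k : ℕ) → Set
LowerOK a n k = (suc a) ^ (n ∸ 1) * (a ^ k * (a ∸ 1) ^ k) ≤ (suc a) ^ (2 * k) * a ^ (n ∸ 1)

-- k ≤ (n-1) x₂⋆ + 1, equivalently
-- ((a+1)²/(a(a-1)))^k ≤ ((a+1)²/(a(a-1))) · ((a+1)/a)^(n-1), cleared of denominators.
UpperOK : (a n k : ℕ) → Set
UpperOK a n k = (suc a) ^ (2 * k) * a ^ (n ∸ 1) * (a * (a ∸ 1))
                ≤ (suc a) ^ 2 * (suc a) ^ (n ∸ 1) * (a ^ k * (a ∸ 1) ^ k)

{-# OPTIONS --safe #-}
module Submission where

-- P of a graph with canonical partition V₀ ⊔ V₁ depends only on k = |V₀| and m = |V₁|: it is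
-- (a-1)^C(k,2) · a^C(m,2) · (a+1)^(km).  Adding a vertex to V₀ multiplies it by (a-1)^k (a+1)^m,
-- adding one to V₁ by a^m (a+1)^k.  Maximality of P against the graph with one vertex moved from
-- V₁ to V₀ (resp. from V₀ to V₁) compares these two gains, and each comparison, rearranged, is one
-- of the two bounds on k (which in logarithms read (n-1) x₂⋆ ≤ k ≤ (n-1) x₂⋆ + 1).  The
-- comparisons need P > 0, hence a ≥ 2.  When V₁ (resp. V₀) is empty there is no vertex to move,
-- and the lower (resp. upper) bound holds outright.

open import Defs
open import Data.Nat using (ℕ; zero; suc; _+_; _*_; _∸_; _^_; _≤_; NonZero; s≤s; z<s; s<s)
open import Data.Nat.Properties
open import Data.Nat.Combinatorics using (_C_; nC1≡n; nCk+nC[k+1]≡[n+1]C[k+1])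
open import Data.Nat.Tactic.RingSolver using (solve-∀)
open import Algebra.Properties.CommutativeSemigroup *-commutativeSemigroup using (x∙yz≈y∙xz)
open import Data.Nat.ListAction using (product)
open import Data.Bool using (Bool)
open import Data.Fin using (_<_) renaming (zero to fzero; suc to fsuc)
open import Data.Fin.Subset using (Subset; ∣_∣; ∁; inside; outside)
open import Data.Fin.Subset.Properties using (∣p∣≤n; ∣∁p∣≡n∸∣p∣)
open import Data.Vec using ([]; _∷_; lookup)
open import Data.List using (map; tabulate; allFin)
open import Data.List.Properties using (map-cong; map-tabulate)
open import Data.Product using (Σ-syntax; _×_; _,_)
open import Function using (id; _∘_)
open import Relation.Binary.PropositionalEquality
  using (_≡_; refl; sym; trans; cong; cong₂; subst; subst₂; module ≡-Reasoning)

P-cong : ∀ n {w v : Multigraph n} → (∀ i j → i < j → w i j ≡ v i j) → P n w ≡ P n v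
P-cong zero    w≡v = refl
P-cong (suc n) w≡v = cong₂ _*_
  (cong product (map-cong (λ j → w≡v fzero (fsuc j) z<s) (allFin n)))
  (P-cong n (λ i j i<j → w≡v (fsuc i) (fsuc j) (s<s i<j)))

product-tabulate-lookup : ∀ (f : Bool → ℕ) {n} (p : Subset n) →
  product (tabulate (f ∘ lookup p)) ≡ f inside ^ ∣ p ∣ * f outside ^ ∣ ∁ p ∣
product-tabulate-lookup f []            = refl
product-tabulate-lookup f (inside ∷ p)  = trans (cong (f inside *_) (product-tabulate-lookup f p))
  (sym (*-assoc (f inside) (f inside ^ ∣ p ∣) (f outside ^ ∣ ∁ p ∣)))
product-tabulate-lookup f (outside ∷ p) = trans (cong (f outside *_) (product-tabulate-lookup f p))
  (x∙yz≈y∙xz (f outside) (f inside ^ ∣ p ∣) (f outside ^ ∣ ∁ p ∣))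

product-map-lookup-allFin : ∀ (f : Bool → ℕ) {n} (p : Subset n) →
  product (map (f ∘ lookup p) (allFin n)) ≡ f inside ^ ∣ p ∣ * f outside ^ ∣ ∁ p ∣
product-map-lookup-allFin f p =
  trans (cong product (map-tabulate id (f ∘ lookup p))) (product-tabulate-lookup f p)

∣p∣+∣∁p∣≡n : ∀ {n} (p : Subset n) → ∣ p ∣ + ∣ ∁ p ∣ ≡ n
∣p∣+∣∁p∣≡n p = trans (cong (∣ p ∣ +_) (∣∁p∣≡n∸∣p∣ p)) (m+[n∸m]≡n (∣p∣≤n p))

subsetOfSizes : ∀ {n} k m → k + m ≡ n → Σ[ q ∈ Subset n ] ∣ q ∣ ≡ k × ∣ ∁ q ∣ ≡ m
subsetOfSizes zero    zero    refl = [] , refl , refl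
subsetOfSizes zero    (suc m) refl with subsetOfSizes zero m refl
... | q , ∣q∣≡0 , ∣∁q∣≡m = outside ∷ q , ∣q∣≡0 , cong suc ∣∁q∣≡m
subsetOfSizes (suc k) m       refl with subsetOfSizes k m refl
... | q , ∣q∣≡k , ∣∁q∣≡m = inside ∷ q , cong suc ∣q∣≡k , ∣∁q∣≡m

[1+n]C2≡n+nC2 : ∀ n → suc n C 2 ≡ n + n C 2
[1+n]C2≡n+nC2 n = trans (sym (nCk+nC[k+1]≡[n+1]C[k+1] n 1)) (cong (_+ n C 2) (nC1≡n n))

m^[2*n]≡m^n*m^n : ∀ m n → m ^ (2 * n) ≡ m ^ n * m ^ n
m^[2*n]≡m^n*m^n m n =
  trans (^-distribˡ-+-* m n (n + 0)) (cong (λ e → m ^ n * m ^ e) (+-identityʳ n))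

canonicalGraph : ℕ → ∀ {n} → Subset n → Multigraph n
canonicalGraph a p i j = multB a (lookup p i) (lookup p j)

partitionProduct : ℕ → ℕ → ℕ → ℕ
partitionProduct a k m = (a ∸ 1) ^ (k C 2) * a ^ (m C 2) * suc a ^ (k * m)

module _ (a : ℕ) where
  private
    b s : ℕ
    b = a ∸ 1
    s = suc a

    a≤s : a ≤ s
    a≤s = n≤1+n a

    b≤s : b ≤ s
    b≤s = ≤-trans (m∸n≤m a 1) a≤s

  gainˡ gainʳ : ℕ → ℕ → ℕ
  gainˡ k m = b ^ k * s ^ m
  gainʳ k m = a ^ m * s ^ k

  partitionProduct-sucˡ : ∀ k m → partitionProduct a (suc k) m ≡ partitionProduct a k m * gainˡ k m
  partitionProduct-sucˡ k m = begin
    b ^ (suc k C 2) * a ^ (m C 2) * s ^ (m + k * m)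
      ≡⟨ cong₂ (λ e f → e * a ^ (m C 2) * f)
           (trans (cong (b ^_) ([1+n]C2≡n+nC2 k)) (^-distribˡ-+-* b k (k C 2)))
           (^-distribˡ-+-* s m (k * m)) ⟩
    b ^ k * b ^ (k C 2) * a ^ (m C 2) * (s ^ m * s ^ (k * m))
      ≡⟨ regroup (b ^ k) (b ^ (k C 2)) (a ^ (m C 2)) (s ^ m) (s ^ (k * m)) ⟩
    partitionProduct a k m * (b ^ k * s ^ m) ∎
    where
    open ≡-Reasoning
    regroup : ∀ x y z u v → x * y * z * (u * v) ≡ y * z * v * (x * u)
    regroup = solve-∀

  partitionProduct-sucʳ : ∀ k m → partitionProduct a k (suc m) ≡ partitionProduct a k m * gainʳ k m
  partitionProduct-sucʳ k m = begin
    b ^ (k C 2) * a ^ (suc m C 2) * s ^ (k * suc m)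
      ≡⟨ cong₂ (λ e f → b ^ (k C 2) * e * f)
           (trans (cong (a ^_) ([1+n]C2≡n+nC2 m)) (^-distribˡ-+-* a m (m C 2)))
           (trans (cong (s ^_) (*-suc k m)) (^-distribˡ-+-* s k (k * m))) ⟩
    b ^ (k C 2) * (a ^ m * a ^ (m C 2)) * (s ^ k * s ^ (k * m))
      ≡⟨ regroup (b ^ (k C 2)) (a ^ m) (a ^ (m C 2)) (s ^ k) (s ^ (k * m)) ⟩
    partitionProduct a k m * (a ^ m * s ^ k) ∎
    where
    open ≡-Reasoning
    regroup : ∀ x u y v z → x * (u * y) * (v * z) ≡ x * y * z * (u * v)
    regroup = solve-∀

  P-canonicalGraph : ∀ {n} (p : Subset n) →
    P n (canonicalGraph a p) ≡ partitionProduct a ∣ p ∣ ∣ ∁ p ∣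
  P-canonicalGraph []            = refl
  P-canonicalGraph {suc n} (x ∷ p) = begin
    product (map (multB a x ∘ lookup p) (allFin n)) * P n (canonicalGraph a p)
      ≡⟨ cong₂ _*_ (product-map-lookup-allFin (multB a x) p) (P-canonicalGraph p) ⟩
    multB a x inside ^ k * multB a x outside ^ m * partitionProduct a k m
      ≡⟨ *-comm _ (partitionProduct a k m) ⟩
    partitionProduct a k m * (multB a x inside ^ k * multB a x outside ^ m)
      ≡⟨ add-vertex x ⟩
    partitionProduct a ∣ x ∷ p ∣ ∣ ∁ (x ∷ p) ∣ ∎
    where
    open ≡-Reasoning
    k m : ℕ
    k = ∣ p ∣
    m = ∣ ∁ p ∣
    add-vertex : ∀ x → partitionProduct a k m * (multB a x inside ^ k * multB a x outside ^ m)
                     ≡ partitionProduct a ∣ x ∷ p ∣ ∣ ∁ (x ∷ p) ∣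
    add-vertex inside  = sym (partitionProduct-sucˡ k m)
    add-vertex outside = trans (cong (partitionProduct a k m *_) (*-comm (s ^ k) (a ^ m)))
                               (sym (partitionProduct-sucʳ k m))

  OptimalSplit : ℕ → ℕ → Set
  OptimalSplit k m = ∀ k′ m′ → k′ + m′ ≡ k + m → partitionProduct a k′ m′ ≤ partitionProduct a k m

  optimalSplit-of-extremal : ∀ {n} {w : Multigraph n} (p : Subset n) →
    InTP21 a n w → IsCanonical a n w p → OptimalSplit ∣ p ∣ ∣ ∁ p ∣
  optimalSplit-of-extremal {n} p (_ , maximal) canonical k′ m′ k′+m′≡ =
    let q , ∣q∣≡k′ , ∣∁q∣≡m′ = subsetOfSizes k′ m′ (trans k′+m′≡ (∣p∣+∣∁p∣≡n p)) in
    subst₂ _≤_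
      (trans (P-canonicalGraph q) (cong₂ (partitionProduct a) ∣q∣≡k′ ∣∁q∣≡m′))
      (trans (P-cong n canonical) (P-canonicalGraph p))
      (maximal (canonicalGraph a q) (q , λ _ _ _ → refl))

  partitionProduct-nonZero : 2 ≤ a → ∀ k m → NonZero (partitionProduct a k m)
  partitionProduct-nonZero (s≤s (s≤s _)) k m =
    m*n≢0 _ _ {{m*n≢0 _ _ {{m^n≢0 b (k C 2)}} {{m^n≢0 a (m C 2)}}}} {{m^n≢0 s (k * m)}}

  gainˡ≤gainʳ : 2 ≤ a → ∀ k m → OptimalSplit k (suc m) → gainˡ k m ≤ gainʳ k m
  gainˡ≤gainʳ 2≤a k m optimal =
    *-cancelˡ-≤ (partitionProduct a k m) {{partitionProduct-nonZero 2≤a k m}}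
      (subst₂ _≤_ (partitionProduct-sucˡ k m) (partitionProduct-sucʳ k m)
        (optimal (suc k) m (sym (+-suc k m))))

  gainʳ≤gainˡ : 2 ≤ a → ∀ k m → OptimalSplit (suc k) m → gainʳ k m ≤ gainˡ k m
  gainʳ≤gainˡ 2≤a k m optimal =
    *-cancelˡ-≤ (partitionProduct a k m) {{partitionProduct-nonZero 2≤a k m}}
      (subst₂ _≤_ (partitionProduct-sucʳ k m) (partitionProduct-sucˡ k m)
        (optimal k (suc m) (+-suc k m)))

  LowerOK-of-gain : ∀ k m → gainˡ k m ≤ gainʳ k m → LowerOK a (suc (k + m)) k
  LowerOK-of-gain k m gainˡ≤gainʳ = begin
    s ^ (k + m) * (a ^ k * b ^ k)
      ≡⟨ cong (_* (a ^ k * b ^ k)) (^-distribˡ-+-* s k m) ⟩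
    s ^ k * s ^ m * (a ^ k * b ^ k)
      ≡⟨ regroupˡ (s ^ k) (s ^ m) (a ^ k) (b ^ k) ⟩
    s ^ k * a ^ k * gainˡ k m
      ≤⟨ *-monoʳ-≤ (s ^ k * a ^ k) gainˡ≤gainʳ ⟩
    s ^ k * a ^ k * gainʳ k m
      ≡⟨ regroupʳ (s ^ k) (a ^ k) (a ^ m) ⟩
    s ^ k * s ^ k * (a ^ k * a ^ m)
      ≡⟨ sym (cong₂ _*_ (m^[2*n]≡m^n*m^n s k) (^-distribˡ-+-* a k m)) ⟩
    s ^ (2 * k) * a ^ (k + m) ∎
    where
    open ≤-Reasoning
    regroupˡ : ∀ x y z u → x * y * (z * u) ≡ x * z * (u * y)
    regroupˡ = solve-∀
    regroupʳ : ∀ x z v → x * z * (v * x) ≡ x * x * (z * v)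
    regroupʳ = solve-∀

  LowerOK-diagonal : ∀ k → LowerOK a k k
  LowerOK-diagonal zero    = ≤-refl
  LowerOK-diagonal (suc k) = begin
    s ^ k * (a * a ^ k * (b * b ^ k))
      ≡⟨ regroupˡ (s ^ k) a (a ^ k) (b * b ^ k) ⟩
    s ^ k * a ^ k * (a * (b * b ^ k))
      ≤⟨ *-monoʳ-≤ (s ^ k * a ^ k) (*-mono-≤ a≤s (*-mono-≤ b≤s (^-monoˡ-≤ k b≤s))) ⟩
    s ^ k * a ^ k * (s * (s * s ^ k))
      ≡⟨ regroupʳ (s ^ k) (a ^ k) s ⟩
    s ^ suc k * s ^ suc k * a ^ k
      ≡⟨ sym (cong (_* a ^ k) (m^[2*n]≡m^n*m^n s (suc k))) ⟩
    s ^ (2 * suc k) * a ^ k ∎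
    where
    open ≤-Reasoning
    regroupˡ : ∀ x y z u → x * (y * z * u) ≡ x * z * (y * u)
    regroupˡ = solve-∀
    regroupʳ : ∀ x z y → x * z * (y * (y * x)) ≡ y * x * (y * x) * z
    regroupʳ = solve-∀

  UpperOK-of-gain : ∀ k m → gainʳ k m ≤ gainˡ k m → UpperOK a (suc (k + m)) (suc k)
  UpperOK-of-gain k m gainʳ≤gainˡ = begin
    s ^ (2 * suc k) * a ^ (k + m) * (a * b)
      ≡⟨ cong₂ (λ e f → e * f * (a * b)) (m^[2*n]≡m^n*m^n s (suc k)) (^-distribˡ-+-* a k m) ⟩
    s * s ^ k * (s * s ^ k) * (a ^ k * a ^ m) * (a * b)
      ≡⟨ regroupˡ s (s ^ k) (a ^ k) (a ^ m) a b ⟩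
    s * s * s ^ k * a ^ k * a * b * gainʳ k m
      ≤⟨ *-monoʳ-≤ (s * s * s ^ k * a ^ k * a * b) gainʳ≤gainˡ ⟩
    s * s * s ^ k * a ^ k * a * b * gainˡ k m
      ≡⟨ regroupʳ s (s ^ k) (a ^ k) a b (b ^ k) (s ^ m) ⟩
    s ^ 2 * (s ^ k * s ^ m) * (a ^ suc k * b ^ suc k)
      ≡⟨ cong (λ e → s ^ 2 * e * (a ^ suc k * b ^ suc k)) (sym (^-distribˡ-+-* s k m)) ⟩
    s ^ 2 * s ^ (k + m) * (a ^ suc k * b ^ suc k) ∎
    where
    open ≤-Reasoning
    regroupˡ : ∀ y S A E x z → y * S * (y * S) * (A * E) * (x * z) ≡ y * y * S * A * x * z * (E * S)
    regroupˡ = solve-∀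
    regroupʳ : ∀ y S A x z B T →
      y * y * S * A * x * z * (B * T) ≡ y * (y * 1) * (S * T) * (x * A * (z * B))
    regroupʳ = solve-∀

  UpperOK-zero : ∀ n → UpperOK a n 0
  UpperOK-zero n = begin
    1 * a ^ (n ∸ 1) * (a * b)
      ≡⟨ regroupˡ (a ^ (n ∸ 1)) (a * b) ⟩
    a ^ (n ∸ 1) * (a * b)
      ≤⟨ *-mono-≤ (^-monoˡ-≤ (n ∸ 1) a≤s) (*-mono-≤ a≤s b≤s) ⟩
    s ^ (n ∸ 1) * (s * s)
      ≡⟨ regroupʳ s (s ^ (n ∸ 1)) ⟩
    s ^ 2 * s ^ (n ∸ 1) * (1 * 1) ∎
    where
    open ≤-Reasoning
    regroupˡ : ∀ x y → 1 * x * y ≡ x * y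
    regroupˡ = solve-∀
    regroupʳ : ∀ y S → S * (y * y) ≡ y * (y * 1) * S * (1 * 1)
    regroupʳ = solve-∀

  optimalSplit-LowerOK : 2 ≤ a → ∀ k m → OptimalSplit k m → LowerOK a (k + m) k
  optimalSplit-LowerOK 2≤a k zero    _       =
    subst (λ n → LowerOK a n k) (sym (+-identityʳ k)) (LowerOK-diagonal k)
  optimalSplit-LowerOK 2≤a k (suc m) optimal =
    subst (λ n → LowerOK a n k) (sym (+-suc k m))
      (LowerOK-of-gain k m (gainˡ≤gainʳ 2≤a k m optimal))

  optimalSplit-UpperOK : 2 ≤ a → ∀ k m → OptimalSplit k m → UpperOK a (k + m) k
  optimalSplit-UpperOK 2≤a zero    m _       = UpperOK-zero m
  optimalSplit-UpperOK 2≤a (suc k) m optimal = UpperOK-of-gain k m (gainʳ≤gainˡ 2≤a k m optimal)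

-- The bounds hold for every n.
lemma9p7 : (a n : ℕ) → 2 ≤ a → 2 ≤ n → (w : Multigraph n) → InTP21 a n w →
    (p : Subset n) → IsCanonical a n w p →
    LowerOK a n ∣ p ∣ × UpperOK a n ∣ p ∣
lemma9p7 a n 2≤a _ _ extremal p canonical =
  subst (λ n → LowerOK a n k × UpperOK a n k) (∣p∣+∣∁p∣≡n p)
    (optimalSplit-LowerOK a 2≤a k m optimal , optimalSplit-UpperOK a 2≤a k m optimal)
  where
  k m : ℕ
  k = ∣ p ∣
  m = ∣ ∁ p ∣
  optimal : OptimalSplit a k m
  optimal = optimalSplit-of-extremal a p extremal canonical
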